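{- Let $q$ be a prime power and let $0\le k\le n$ be integers. Then $$\begin{bmatrix} n\\ k\end{bmatrix}_q \;=\; \sum_{P\in\mathcal{M}(n)} (q-1)^{|P|}\, w(P,q)\,\binom{n-2|P|}{k-|P|}.$$
   Context: $\begin{bmatrix} n\\ k\end{bmatrix}_q$ denotes the $q$-binomial (Gaussian) coefficient, i.e. the number of $k$-dimensional subspaces of $\mathbb{F}_q^n$. The ordinary binomial coefficient $\binom{a}{b}$ is taken to be $0$ if $b<0$ or $b>a$. $\mathcal{M}(n)$ is the set of Motzkin paths from $(0,0)$ to $(n,0)$: lattice paths with steps $(1,0)$ (horizontal step $H$), $(1,1)$ (up step $U$) and $(1,-1)$ (down step $D$) that never go strictly below the $x$-axis. For $P\in\mathcal{M}(n)$, $|P|$ is the number of down steps of $P$. The weight of an up step is $1$; the weight of a horizontal step from $(i,j)$ to $(i+1,j)$ is $q^j$; the weight of a down step from $(i,j+1)$ to $(i+1,j)$ is $q^j+q^{j+1}+\cdots+q^{2j}$. The weight $w(P,q)$ of $P$ is the product of the weights of its steps. -}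

module Defs where

open import Data.Nat using (ℕ; zero; suc; _+_; _*_; _∸_; _^_; _<ᵇ_)
open import Data.Nat.Combinatorics using (_C_)
open import Data.List using (List; []; _∷_; map; _++_)
open import Data.Bool using (if_then_else_)
open import Data.Product using (Σ; _×_)
open import Data.Nat.Primality using (Prime)
open import Relation.Binary.PropositionalEquality using (_≡_)

qbinom : ℕ → ℕ → ℕ → ℕ
qbinom q n       zero    = 1
qbinom q zero    (suc k) = 0
qbinom q (suc n) (suc k) = qbinom q n k + q ^ suc k * qbinom q n (suc k)

-- Ordinary binomial with integer arguments a - b convention:
-- binomZ a b c d represents binom(a - b, c - d) (as integers), which is 0
-- when the top or bottom is negative; _C_ is already 0 when bottom > top.
binomZ : ℕ → ℕ → ℕ → ℕ → ℕ
binomZ a b c d = if (a <ᵇ b) then 0 else (if (c <ᵇ d) then 0 else (a ∸ b) C (c ∸ d))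

-- Motzkin path suffixes: Mot n h = lattice paths of n steps from height h
-- to height 0 never going below the x-axis.  The step constructors record
-- the step taken first.
data Mot : ℕ → ℕ → Set where
  end : Mot zero zero
  H   : ∀ {n h} → Mot n h → Mot (suc n) h
  U   : ∀ {n h} → Mot n (suc h) → Mot (suc n) h
  D   : ∀ {n h} → Mot n h → Mot (suc n) (suc h)

Motzkin : ℕ → Set
Motzkin n = Mot n zero

allMot : (n h : ℕ) → List (Mot n h)
allMot zero    zero    = end ∷ []
allMot zero    (suc h) = []
allMot (suc n) h       = map H (allMot n h) ++ (map U (allMot n (suc h)) ++ downs h)
  where
    downs : (h : ℕ) → List (Mot (suc n) h)
    downs zero    = []
    downs (suc j) = map D (allMot n j)

downs : ∀ {n h} → Mot n h → ℕ
downs end   = 0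
downs (H p) = downs p
downs (U p) = downs p
downs (D p) = suc (downs p)

geomFrom : ℕ → ℕ → ℕ → ℕ
geomFrom q j zero    = q ^ j
geomFrom q j (suc m) = q ^ (j + suc m) + geomFrom q j m

weight : ℕ → ∀ {n h} → Mot n h → ℕ
weight q end             = 1
weight q {h = h} (H p)   = q ^ h * weight q p
weight q (U p)           = weight q p
weight q {h = suc j} (D p) = geomFrom q j j * weight q p

IsPrimePower : ℕ → Set
IsPrimePower q = Σ ℕ λ p → Σ ℕ λ e → (Prime p × q ≡ p ^ suc e)

-- Write q = 1 + r and let a path start at height h instead of 0.  Summing the weighted terms over the
-- paths of length m starting at height h gives  c_h [m,k]_q [k,h]_q,  where c_h is the product of the
-- rescaled down-step weights r (q^j + ... + q^2j) for j < h.  Both sides obey the same recursion in m,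
-- obtained on the path side by splitting off the first step: a horizontal step contributes an ordinary
-- Pascal rule, a down step lowers k.  On the closed-form side the recursion reduces to the q-Pascal rule
-- together with  q^k [k,h] = q^h [k,h] + r (q^h + ... + q^2h) [k,h+1],  a subtraction-free form of
-- (q^(k-h) - 1) [k,h] = (q^(h+1) - 1) [k,h+1].  The theorem is the case h = 0.
module Submission where

open import Defs
open import Data.Nat using (ℕ; zero; suc; _≤_; _+_; _*_; _∸_; _^_; _<ᵇ_)
open import Data.Nat.Properties
  using ( +-suc; +-comm; +-identityʳ; +-cancelʳ-≡; *-identityˡ; *-identityʳ; *-zeroʳ; *-assoc; *-distribˡ-+
        ; ^-distribˡ-+-*; m+n∸n≡m; m^n≡0⇒m≡0; +-commutativeSemigroup)
open import Algebra.Properties.CommutativeSemigroup +-commutativeSemigroup using () renaming (interchange to +-interchange)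
open import Data.Nat.Combinatorics using (_C_; nCk+nC[k+1]≡[n+1]C[k+1])
open import Data.Nat.Primality using (Prime; ¬prime[0])
open import Data.Nat.ListAction using (sum)
open import Data.Nat.ListAction.Properties using (sum-++)
open import Data.Nat.Tactic.RingSolver using (solve-∀)
open import Data.List using (List; []; _∷_; _++_; map)
open import Data.List.Properties using (map-++; map-∘; map-cong)
open import Data.Bool using (false; if_then_else_)
open import Data.Product using (_,_)
open import Data.Empty using (⊥-elim)
open import Function using (_∘_)
open import Relation.Binary.PropositionalEquality
  using (_≡_; refl; sym; trans; cong; cong₂; subst; module ≡-Reasoning)

open ≡-Reasoning

shift : (ℕ → ℕ) → ℕ → ℕ
shift f zero    = 0
shift f (suc k) = f k

shift-cong : {f g : ℕ → ℕ} → (∀ k → f k ≡ g k) → ∀ k → shift f k ≡ shift g k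
shift-cong f≗g zero    = refl
shift-cong f≗g (suc k) = f≗g k

shift-*ˡ : (c : ℕ) (f : ℕ → ℕ) (k : ℕ) → shift (λ i → c * f i) k ≡ c * shift f k
shift-*ˡ c f zero    = sym (*-zeroʳ c)
shift-*ˡ c f (suc k) = refl

module _ {A : Set} where

  sum-map-++ : (f : A → ℕ) (xs ys : List A) → sum (map f (xs ++ ys)) ≡ sum (map f xs) + sum (map f ys)
  sum-map-++ f xs ys = trans (cong sum (map-++ f xs ys)) (sum-++ (map f xs) (map f ys))

  sum-map-map : {B : Set} (f : A → ℕ) (g : B → A) (xs : List B) → sum (map f (map g xs)) ≡ sum (map (f ∘ g) xs)
  sum-map-map f g xs = cong sum (sym (map-∘ xs))

  sum-map-cong : {f g : A → ℕ} → (∀ x → f x ≡ g x) → (xs : List A) → sum (map f xs) ≡ sum (map g xs)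
  sum-map-cong f≗g xs = cong sum (map-cong f≗g xs)

  sum-map-zero : (xs : List A) → sum (map (λ _ → 0) xs) ≡ 0
  sum-map-zero []       = refl
  sum-map-zero (_ ∷ xs) = sum-map-zero xs

  sum-map-*ˡ : (c : ℕ) (f : A → ℕ) (xs : List A) → sum (map (λ x → c * f x) xs) ≡ c * sum (map f xs)
  sum-map-*ˡ c f []       = sym (*-zeroʳ c)
  sum-map-*ˡ c f (x ∷ xs) = trans (cong (c * f x +_) (sum-map-*ˡ c f xs)) (sym (*-distribˡ-+ c (f x) _))

  sum-map-+ : (f g : A → ℕ) (xs : List A) →
              sum (map (λ x → f x + g x) xs) ≡ sum (map f xs) + sum (map g xs)
  sum-map-+ f g []       = refl
  sum-map-+ f g (x ∷ xs) = trans (cong (f x + g x +_) (sum-map-+ f g xs)) (+-interchange (f x) (g x) _ _)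

  sum-map-shift : (f : A → ℕ → ℕ) (xs : List A) (k : ℕ) →
                  sum (map (λ x → shift (f x) k) xs) ≡ shift (λ i → sum (map (λ x → f x i) xs)) k
  sum-map-shift f xs zero    = sum-map-zero xs
  sum-map-shift f xs (suc k) = refl

binomShift : ℕ → ℕ → ℕ → ℕ
binomShift zero    n = n C_
binomShift (suc d) n = shift (binomShift d n)

binomShift-pascal : ∀ d n k → binomShift d (suc n) k ≡ binomShift d n k + binomShift (suc d) n k
binomShift-pascal zero    n zero    = refl
binomShift-pascal zero    n (suc k) = trans (sym (nCk+nC[k+1]≡[n+1]C[k+1] n k)) (+-comm (n C k) _)
binomShift-pascal (suc d) n zero    = refl
binomShift-pascal (suc d) n (suc k) = binomShift-pascal d n k

binomShift-if : ∀ d n k → binomShift d n k ≡ (if k <ᵇ d then 0 else n C (k ∸ d))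
binomShift-if zero    n k       = refl
binomShift-if (suc d) n zero    = refl
binomShift-if (suc d) n (suc k) = binomShift-if d n k

m+n≮ᵇn : ∀ m n → (m + n <ᵇ n) ≡ false
m+n≮ᵇn m zero    = refl
m+n≮ᵇn m (suc n) rewrite +-suc m n = m+n≮ᵇn m n

binomZ-binomShift : ∀ n d k → binomZ (n + (d + d)) (d + d) k d ≡ binomShift d n k
binomZ-binomShift n d k rewrite m+n≮ᵇn n (d + d) | m+n∸n≡m n (d + d) = sym (binomShift-if d n k)

horizontalSteps : ∀ {n h} → Mot n h → ℕ
horizontalSteps end   = 0
horizontalSteps (H p) = suc (horizontalSteps p)
horizontalSteps (U p) = horizontalSteps p
horizontalSteps (D p) = horizontalSteps p

horizontalSteps+2*downs : ∀ {n h} (P : Mot n h) → horizontalSteps P + (downs P + downs P) ≡ n + h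
horizontalSteps+2*downs end               = refl
horizontalSteps+2*downs (H p)             = cong suc (horizontalSteps+2*downs p)
horizontalSteps+2*downs {suc n} {h} (U p) = trans (horizontalSteps+2*downs p) (+-suc n h)
horizontalSteps+2*downs {suc n} {suc h} (D p) = begin
  horizontalSteps p + (suc (downs p) + suc (downs p)) ≡⟨ two-more (horizontalSteps p) (downs p) ⟩
  suc (suc (horizontalSteps p + (downs p + downs p))) ≡⟨ cong (suc ∘ suc) (horizontalSteps+2*downs p) ⟩
  suc (suc (n + h))                                   ≡⟨ cong suc (sym (+-suc n h)) ⟩
  suc n + suc h                                       ∎
  where
  two-more : ∀ a b → a + (suc b + suc b) ≡ suc (suc (a + (b + b)))
  two-more = solve-∀

binomZ-path : ∀ {n} (P : Mot n 0) k →
              binomZ n (downs P + downs P) k (downs P) ≡ binomShift (downs P) (horizontalSteps P) k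
binomZ-path {n} P k =
  subst (λ m → binomZ m (d + d) k d ≡ binomShift d (horizontalSteps P) k)
        (trans (horizontalSteps+2*downs P) (+-identityʳ n))
        (binomZ-binomShift (horizontalSteps P) d k)
  where
  d = downs P

qbinom-suc : ∀ q n k → qbinom q (suc n) k ≡ shift (qbinom q n) k + q ^ k * qbinom q n k
qbinom-suc q n zero    = refl
qbinom-suc q n (suc k) = refl

-- The q-Pascal rule [k+1,h+1] = q^(k-h) [k,h] + [k,h+1], multiplied by q^h.
qbinom-dualPascal : ∀ q k h →
                    q ^ h * qbinom q (suc k) (suc h) ≡ q ^ k * qbinom q k h + q ^ h * qbinom q k (suc h)
qbinom-dualPascal q zero zero = base q
  where
  base : ∀ q → 1 * (1 + q * 1 * 0) ≡ 1 * 1 + 1 * 0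
  base = solve-∀
qbinom-dualPascal q zero (suc h) = base (q ^ suc h) (q ^ suc (suc h))
  where
  base : ∀ a b → a * (0 + b * 0) ≡ 1 * 0 + a * 0
  base = solve-∀
qbinom-dualPascal q (suc k) zero = sym (begin
  q * q ^ k * 1 + 1 * (1 + q * 1 * b)   ≡⟨ regroup q (q ^ k) b ⟩
  1 + q * (q ^ k * 1 + 1 * b)           ≡⟨ cong (λ x → 1 + q * x) (sym (qbinom-dualPascal q k zero)) ⟩
  1 + q * (1 * qbinom q (suc k) 1)      ≡⟨ ungroup q (qbinom q (suc k) 1) ⟩
  1 * (1 + q * 1 * qbinom q (suc k) 1)  ∎)
  where
  b = qbinom q k 1
  regroup : ∀ q x b → q * x * 1 + 1 * (1 + q * 1 * b) ≡ 1 + q * (x * 1 + 1 * b)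
  regroup = solve-∀
  ungroup : ∀ q a → 1 + q * (1 * a) ≡ 1 * (1 + q * 1 * a)
  ungroup = solve-∀
qbinom-dualPascal q (suc k) (suc h) = sym (begin
  q * q ^ k * (a + q * q ^ h * b) + q * q ^ h * (b + q * (q * q ^ h) * c)
    ≡⟨ regroup q (q ^ k) (q ^ h) a b c ⟩
  q * (q ^ k * a + q ^ h * b) + q * (q * q ^ h) * (q ^ k * b + q * q ^ h * c)
    ≡⟨ cong₂ (λ x y → q * x + q * (q * q ^ h) * y)
             (sym (qbinom-dualPascal q k h)) (sym (qbinom-dualPascal q k (suc h))) ⟩
  q * (q ^ h * qbinom q (suc k) (suc h)) + q * (q * q ^ h) * (q * q ^ h * qbinom q (suc k) (suc (suc h)))
    ≡⟨ ungroup q (q ^ h) (qbinom q (suc k) (suc h)) (qbinom q (suc k) (suc (suc h))) ⟩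
  q * q ^ h * (qbinom q (suc k) (suc h) + q * (q * q ^ h) * qbinom q (suc k) (suc (suc h))) ∎)
  where
  a = qbinom q k h
  b = qbinom q k (suc h)
  c = qbinom q k (suc (suc h))
  regroup : ∀ q x y a b c → q * x * (a + q * y * b) + q * y * (b + q * (q * y) * c)
                          ≡ q * (x * a + y * b) + q * (q * y) * (x * b + q * y * c)
  regroup = solve-∀
  ungroup : ∀ q y u v → q * (y * u) + q * (q * y) * (q * y * v) ≡ q * y * (u + q * (q * y) * v)
  ungroup = solve-∀

module MotzkinExpansion (r : ℕ) where

  q : ℕ
  q = suc r

  -- (q - 1) times the weight of a down step ending at height j
  downFactor : ℕ → ℕ
  downFactor j = r * geomFrom q j j

  downProduct : ℕ → ℕ
  downProduct zero    = 1
  downProduct (suc j) = downFactor j * downProduct j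

  geomFrom-telescope : ∀ j m → q ^ j * q ^ suc m ≡ q ^ j + r * geomFrom q j m
  geomFrom-telescope j zero    = base r (q ^ j)
    where
    base : ∀ r x → x * (suc r * 1) ≡ x + r * x
    base = solve-∀
  geomFrom-telescope j (suc m) = begin
    q ^ j * (q * q ^ suc m)                        ≡⟨ expand r (q ^ j) (q ^ suc m) ⟩
    q ^ j * q ^ suc m + r * (q ^ j * q ^ suc m)    ≡⟨ cong (_+ r * (q ^ j * q ^ suc m)) (geomFrom-telescope j m) ⟩
    q ^ j + r * geomFrom q j m + r * (q ^ j * q ^ suc m)
                                                   ≡⟨ collect r (q ^ j) (geomFrom q j m) (q ^ j * q ^ suc m) ⟩
    q ^ j + r * (q ^ j * q ^ suc m + geomFrom q j m)
                                                   ≡⟨ cong (λ x → q ^ j + r * (x + geomFrom q j m)) (sym (^-distribˡ-+-* q j (suc m))) ⟩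
    q ^ j + r * geomFrom q j (suc m)               ∎
    where
    expand : ∀ r x y → x * (suc r * y) ≡ x * y + r * (x * y)
    expand = solve-∀
    collect : ∀ r x g y → x + r * g + r * y ≡ x + r * (y + g)
    collect = solve-∀

  power-qbinom-split : ∀ k h → q ^ k * qbinom q k h ≡ q ^ h * qbinom q k h + downFactor h * qbinom q k (suc h)
  power-qbinom-split k h = +-cancelʳ-≡ (q ^ h * b) _ _ (begin
    q ^ k * a + q ^ h * b                       ≡⟨ sym (qbinom-dualPascal q k h) ⟩
    q ^ h * (a + q ^ suc h * b)                 ≡⟨ distrib (q ^ h) (q ^ suc h) a b ⟩
    q ^ h * a + q ^ h * q ^ suc h * b           ≡⟨ cong (λ x → q ^ h * a + x * b) (geomFrom-telescope h h) ⟩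
    q ^ h * a + (q ^ h + downFactor h) * b      ≡⟨ regroup (q ^ h) (downFactor h) a b ⟩
    q ^ h * a + downFactor h * b + q ^ h * b    ∎)
    where
    a = qbinom q k h
    b = qbinom q k (suc h)
    distrib : ∀ x y a b → x * (a + y * b) ≡ x * a + x * y * b
    distrib = solve-∀
    regroup : ∀ x d a b → x * a + (x + d) * b ≡ x * a + d * b + x * b
    regroup = solve-∀

  term : ∀ {n h} → Mot n h → ℕ → ℕ
  term P k = r ^ downs P * weight q P * binomShift (downs P) (horizontalSteps P) k

  term-H : ∀ {n h} (p : Mot n h) k → term (H p) k ≡ q ^ h * (term p k + shift (term p) k)
  term-H {h = h} p k = begin
    c * (q ^ h * w) * binomShift d (suc x) k
      ≡⟨ cong (c * (q ^ h * w) *_) (binomShift-pascal d x k) ⟩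
    c * (q ^ h * w) * (binomShift d x k + shift (binomShift d x) k)
      ≡⟨ regroup c (q ^ h) w (binomShift d x k) (shift (binomShift d x) k) ⟩
    q ^ h * (term p k + c * w * shift (binomShift d x) k)
      ≡⟨ cong (λ y → q ^ h * (term p k + y)) (sym (shift-*ˡ (c * w) (binomShift d x) k)) ⟩
    q ^ h * (term p k + shift (term p) k) ∎
    where
    d = downs p
    x = horizontalSteps p
    c = r ^ d
    w = weight q p
    regroup : ∀ c y w u v → c * (y * w) * (u + v) ≡ y * (c * w * u + c * w * v)
    regroup = solve-∀

  term-D : ∀ {n j} (p : Mot n j) k → term (D p) k ≡ downFactor j * shift (term p) k
  term-D {j = j} p k = begin
    r * c * (geomFrom q j j * w) * shift (binomShift (downs p) (horizontalSteps p)) k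
      ≡⟨ regroup r c (geomFrom q j j) w _ ⟩
    downFactor j * (c * w * shift (binomShift (downs p) (horizontalSteps p)) k)
      ≡⟨ cong (downFactor j *_) (sym (shift-*ˡ (c * w) _ k)) ⟩
    downFactor j * shift (term p) k ∎
    where
    c = r ^ downs p
    w = weight q p
    regroup : ∀ r c g w u → r * c * (g * w) * u ≡ r * g * (c * w * u)
    regroup = solve-∀

  pathSum : ℕ → ℕ → ℕ → ℕ
  pathSum m h k = sum (map (λ P → term P k) (allMot m h))

  downTerm : (ℕ → ℕ → ℕ) → ℕ → ℕ → ℕ
  downTerm g zero    k = 0
  downTerm g (suc j) k = downFactor j * shift (g j) k

  -- If g h k is the value for paths of length m, motzkinStep g h k is the one for length m + 1,
  -- split by the first step: H at height h, U to height h + 1, D to height h - 1.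
  motzkinStep : (ℕ → ℕ → ℕ) → ℕ → ℕ → ℕ
  motzkinStep g h k = q ^ h * (g h k + shift (g h) k) + (g (suc h) k + downTerm g h k)

  motzkinStep-cong : ∀ {g g′} → (∀ h k → g h k ≡ g′ h k) → ∀ h k → motzkinStep g h k ≡ motzkinStep g′ h k
  motzkinStep-cong g≗g′ h k =
    cong₂ _+_ (cong (q ^ h *_) (cong₂ _+_ (g≗g′ h k) (shift-cong (g≗g′ h) k)))
              (cong₂ _+_ (g≗g′ (suc h) k) (down h))
    where
    down : ∀ h → downTerm _ h k ≡ downTerm _ h k
    down zero    = refl
    down (suc j) = cong (downFactor j *_) (shift-cong (g≗g′ j) k)

  sum-H : ∀ m h k → sum (map (λ P → term P k) (map H (allMot m h))) ≡ q ^ h * (pathSum m h k + shift (pathSum m h) k)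
  sum-H m h k = begin
    sum (map (λ P → term P k) (map H ps))                         ≡⟨ sum-map-map _ H ps ⟩
    sum (map (λ p → term (H p) k) ps)                             ≡⟨ sum-map-cong (λ p → term-H p k) ps ⟩
    sum (map (λ p → q ^ h * (term p k + shift (term p) k)) ps)   ≡⟨ sum-map-*ˡ (q ^ h) _ ps ⟩
    q ^ h * sum (map (λ p → term p k + shift (term p) k) ps)     ≡⟨ cong (q ^ h *_) (sum-map-+ _ _ ps) ⟩
    q ^ h * (pathSum m h k + sum (map (λ p → shift (term p) k) ps))
                                                                 ≡⟨ cong (λ y → q ^ h * (pathSum m h k + y)) (sum-map-shift term ps k) ⟩
    q ^ h * (pathSum m h k + shift (pathSum m h) k)              ∎
    where
    ps = allMot m h

  sum-U : ∀ m h k → sum (map (λ P → term P k) (map U (allMot m (suc h)))) ≡ pathSum m (suc h) k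
  sum-U m h k = sum-map-map _ U (allMot m (suc h))

  sum-D : ∀ m j k → sum (map (λ P → term P k) (map D (allMot m j))) ≡ downFactor j * shift (pathSum m j) k
  sum-D m j k = begin
    sum (map (λ P → term P k) (map D ps))                ≡⟨ sum-map-map _ D ps ⟩
    sum (map (λ p → term (D p) k) ps)                    ≡⟨ sum-map-cong (λ p → term-D p k) ps ⟩
    sum (map (λ p → downFactor j * shift (term p) k) ps) ≡⟨ sum-map-*ˡ (downFactor j) _ ps ⟩
    downFactor j * sum (map (λ p → shift (term p) k) ps) ≡⟨ cong (downFactor j *_) (sum-map-shift term ps k) ⟩
    downFactor j * shift (pathSum m j) k                 ∎
    where
    ps = allMot m j

  pathSum-suc : ∀ m h k → pathSum (suc m) h k ≡ motzkinStep (pathSum m) h k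
  pathSum-suc m zero k =
    trans (sum-map-++ f (map H (allMot m 0)) _)
          (cong₂ _+_ (sum-H m 0 k) (trans (sum-map-++ f (map U (allMot m 1)) []) (cong (_+ 0) (sum-U m 0 k))))
    where
    f = λ (P : Mot (suc m) 0) → term P k
  pathSum-suc m (suc j) k =
    trans (sum-map-++ f (map H (allMot m (suc j))) _)
          (cong₂ _+_ (sum-H m (suc j) k)
                     (trans (sum-map-++ f (map U (allMot m (suc (suc j)))) _) (cong₂ _+_ (sum-U m (suc j) k) (sum-D m j k))))
    where
    f = λ (P : Mot (suc m) (suc j)) → term P k

  closedForm : ℕ → ℕ → ℕ → ℕ
  closedForm m h k = downProduct h * (qbinom q m k * qbinom q k h)

  downTerm-closedForm : ∀ m h k →
    downTerm (closedForm m) h k ≡ downProduct h * shift (λ i → qbinom q m i * shift (qbinom q i) h) k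
  downTerm-closedForm m zero    zero    = refl
  downTerm-closedForm m zero    (suc k) = sym (trans (*-identityˡ _) (*-zeroʳ (qbinom q m k)))
  downTerm-closedForm m (suc j) k =
    trans (cong (downFactor j *_) (shift-*ˡ (downProduct j) _ k)) (sym (*-assoc (downFactor j) (downProduct j) _))

  shifted-qPascal : ∀ m h k →
    q ^ h * shift (λ i → qbinom q m i * qbinom q i h) k + shift (λ i → qbinom q m i * shift (qbinom q i) h) k
      ≡ shift (qbinom q m) k * qbinom q k h
  shifted-qPascal m h zero    = trans (+-identityʳ _) (*-zeroʳ (q ^ h))
  shifted-qPascal m h (suc i) = begin
    q ^ h * (qbinom q m i * qbinom q i h) + qbinom q m i * shift (qbinom q i) h
      ≡⟨ regroup (q ^ h) (qbinom q m i) (qbinom q i h) (shift (qbinom q i) h) ⟩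
    qbinom q m i * (shift (qbinom q i) h + q ^ h * qbinom q i h)
      ≡⟨ cong (qbinom q m i *_) (sym (qbinom-suc q i h)) ⟩
    qbinom q m i * qbinom q (suc i) h ∎
    where
    regroup : ∀ x a b c → x * (a * b) + a * c ≡ a * (c + x * b)
    regroup = solve-∀

  closedForm-suc : ∀ m h k → closedForm (suc m) h k ≡ motzkinStep (closedForm m) h k
  closedForm-suc m h k = sym (begin
    q ^ h * (c * (a * b) + shift (λ i → c * Y i) k) + (d * c * (a * b′) + downTerm (closedForm m) h k)
      ≡⟨ cong₂ (λ s t → q ^ h * (c * (a * b) + s) + (d * c * (a * b′) + t)) (shift-*ˡ c Y k) (downTerm-closedForm m h k) ⟩
    q ^ h * (c * (a * b) + c * shift Y k) + (d * c * (a * b′) + c * shift Z k)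
      ≡⟨ factor (q ^ h) c d a b b′ (shift Y k) (shift Z k) ⟩
    c * (a * (q ^ h * b + d * b′) + (q ^ h * shift Y k + shift Z k))
      ≡⟨ cong₂ (λ s t → c * (a * s + t)) (sym (power-qbinom-split k h)) (shifted-qPascal m h k) ⟩
    c * (a * (q ^ k * b) + shift (qbinom q m) k * b)
      ≡⟨ refactor c a (q ^ k) b (shift (qbinom q m) k) ⟩
    c * ((shift (qbinom q m) k + q ^ k * a) * b)
      ≡⟨ cong (λ s → c * (s * b)) (sym (qbinom-suc q m k)) ⟩
    c * (qbinom q (suc m) k * b) ∎)
    where
    c = downProduct h
    d = downFactor h
    a = qbinom q m k
    b = qbinom q k h
    b′ = qbinom q k (suc h)
    Y = λ i → qbinom q m i * qbinom q i h
    Z = λ i → qbinom q m i * shift (qbinom q i) h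
    factor : ∀ x c d a b b′ y z → x * (c * (a * b) + c * y) + (d * c * (a * b′) + c * z)
                                ≡ c * (a * (x * b + d * b′) + (x * y + z))
    factor = solve-∀
    refactor : ∀ c a x b s → c * (a * (x * b) + s * b) ≡ c * ((s + x * a) * b)
    refactor = solve-∀

  pathSum-zero : ∀ h k → pathSum 0 h k ≡ closedForm 0 h k
  pathSum-zero zero    zero    = refl
  pathSum-zero zero    (suc k) = refl
  pathSum-zero (suc h) zero    = sym (*-zeroʳ (downProduct (suc h)))
  pathSum-zero (suc h) (suc k) = sym (*-zeroʳ (downProduct (suc h)))

  pathSum≡closedForm : ∀ m h k → pathSum m h k ≡ closedForm m h k
  pathSum≡closedForm zero    = pathSum-zero
  pathSum≡closedForm (suc m) h k = begin
    pathSum (suc m) h k            ≡⟨ pathSum-suc m h k ⟩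
    motzkinStep (pathSum m) h k    ≡⟨ motzkinStep-cong (pathSum≡closedForm m) h k ⟩
    motzkinStep (closedForm m) h k ≡⟨ sym (closedForm-suc m h k) ⟩
    closedForm (suc m) h k         ∎

  qbinom-motzkinExpansion : ∀ n k →
    qbinom q n k ≡ sum (map (λ P → r ^ downs P * weight q P * binomZ n (downs P + downs P) k (downs P)) (allMot n 0))
  qbinom-motzkinExpansion n k = begin
    qbinom q n k     ≡⟨ sym (trans (*-identityˡ _) (*-identityʳ (qbinom q n k))) ⟩
    closedForm n 0 k ≡⟨ sym (pathSum≡closedForm n 0 k) ⟩
    pathSum n 0 k    ≡⟨ sum-map-cong (λ P → cong (r ^ downs P * weight q P *_) (sym (binomZ-path P k))) (allMot n 0) ⟩
    sum (map (λ P → r ^ downs P * weight q P * binomZ n (downs P + downs P) k (downs P)) (allMot n 0)) ∎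

open MotzkinExpansion using (qbinom-motzkinExpansion)

mainTheorem1 : (q : ℕ) → IsPrimePower q → (n k : ℕ) → k ≤ n →
    qbinom q n k ≡ sum (map (λ P → (q ∸ 1) ^ downs P * weight q P * binomZ n (downs P + downs P) k (downs P)) (allMot n 0))
mainTheorem1 zero (p , e , p-prime , 0≡p^1+e) n k _ =
  ⊥-elim (¬prime[0] (subst Prime (m^n≡0⇒m≡0 p (suc e) (sym 0≡p^1+e)) p-prime))
mainTheorem1 (suc r) _ n k _ = qbinom-motzkinExpansion r n k
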